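{- Let $G$ be a graph and $D$ an orientation of $G^{(2)}$. Suppose $u_0u_1u_2$ is the unique $u_0$–$u_2$ path in $G$ and $d_D((p,u_0),(q,u_2))=d_D((p,u_2),(q,u_0))=2$ for all $p,q\in\{1,2\}$. Then either $(2,u_1)\to\{(1,u_0),(2,u_0)\}\to(1,u_1)$ and $(1,u_1)\to\{(1,u_2),(2,u_2)\}\to(2,u_1)$ in $D$, or $(1,u_1)\to\{(1,u_0),(2,u_0)\}\to(2,u_1)$ and $(2,u_1)\to\{(1,u_2),(2,u_2)\}\to(1,u_1)$ in $D$.
   Context: $G^{(2)}$ is the graph with vertex set $\{(1,u),(2,u): u\in V(G)\}$ in which $(a,u)$ and $(b,v)$ are adjacent iff $uv\in E(G)$. An orientation assigns a direction to each edge; $x\to y$ denotes the arc from $x$ to $y$, and $x\to\{y,z\}\to w$ means $x\to y$, $x\to z$, $y\to w$, $z\to w$. $d_D(x,y)$ is the length of a shortest directed path from $x$ to $y$ in $D$. -}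

module Defs where

open import Data.Nat using (ℕ; zero; suc; _<_)
open import Data.Fin using (Fin)
open import Data.List using (List; []; _∷_; head; last)
open import Data.Maybe using (just)
open import Data.Product using (Σ; _×_)
open import Data.Sum using (_⊎_)
open import Relation.Nullary using (¬_)
open import Relation.Binary.PropositionalEquality using (_≡_)
open import Data.List.Relation.Unary.Linked using (Linked)
open import Data.List.Relation.Unary.Unique.Propositional using (Unique)

record Graph (n : ℕ) : Set₁ where
  field
    Adj     : Fin n → Fin n → Set
    sym     : ∀ {u v} → Adj u v → Adj v u
    irrefl  : ∀ {u} → ¬ Adj u u
open Graph public

IsPath : ∀ {n} → Graph n → Fin n → Fin n → List (Fin n) → Set
IsPath G u v P = Linked (Adj G) P × Unique P × head P ≡ just u × last P ≡ just v

data Copy : Set where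
  c1 c2 : Copy

V2 : ℕ → Set
V2 n = Copy × Fin n

Adj2 : ∀ {n} → Graph n → V2 n → V2 n → Set
Adj2 G (a Data.Product., u) (b Data.Product., v) = Adj G u v

record Orientation {n} (G : Graph n) : Set₁ where
  field
    Arc      : V2 n → V2 n → Set
    arc-edge : ∀ {x y} → Arc x y → Adj2 G x y
    edge-arc : ∀ {x y} → Adj2 G x y → Arc x y ⊎ Arc y x
    antisym  : ∀ {x y} → Arc x y → ¬ Arc y x
open Orientation public

Walk : ∀ {n} {G : Graph n} → Orientation G → V2 n → V2 n → ℕ → Set
Walk D x y zero    = x ≡ y
Walk D x y (suc k) = Σ (V2 _) λ z → Arc D x z × Walk D z y k

-- d_D(x,y) = k : there is a directed walk of length k, and none shorter
-- (a shortest directed walk is a shortest directed path).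
Dist : ∀ {n} {G : Graph n} → Orientation G → V2 n → V2 n → ℕ → Set
Dist D x y k = Walk D x y k × (∀ j → j < k → ¬ Walk D x y j)

-- x → {y,z} → w
Fan : ∀ {n} {G : Graph n} → Orientation G → V2 n → V2 n → V2 n → V2 n → Set
Fan D x y z w = Arc D x y × Arc D x z × Arc D y w × Arc D z w

-- Since u₁ is the only common neighbour of u₀ and u₂, each of the eight
-- 2-walks guaranteed by the distance hypotheses passes through one of the two
-- copies of u₁. If (1,u₀) → (a,u₁) → (1,u₂), then the walk back from (1,u₂)
-- to (1,u₀) must use the other copy ā, and every remaining walk is then forced
-- through the copy whose arcs point the right way; the resulting arcs are the
-- two fans, with a = 1 and a = 2 giving the two alternatives.
module Submission where

open import Defs
open import Data.Fin using (Fin)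
open import Data.List using ([]; _∷_)
open import Data.Product using (Σ; _×_; _,_; proj₁; proj₂)
open import Data.Sum using (_⊎_; inj₁; inj₂)
open import Data.Empty using (⊥-elim)
open import Function using (case_of_)
open import Relation.Nullary using (¬_)
open import Relation.Binary.PropositionalEquality using (_≡_; _≢_; refl; subst)
open import Data.List.Relation.Unary.Linked using (Linked; [-]; _∷_)
open import Data.List.Relation.Unary.Unique.Propositional using (Unique)
open import Data.List.Relation.Unary.AllPairs using ([]; _∷_)
open import Data.List.Relation.Unary.All using ([]; _∷_)

flip : Copy → Copy
flip c1 = c2
flip c2 = c1

flip-involutive : ∀ a → flip (flip a) ≡ a
flip-involutive c1 = refl
flip-involutive c2 = refl

other-copy : ∀ {P : Copy → Set} a → Σ Copy P → ¬ P a → P (flip a)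
other-copy c1 (c1 , p) ¬p = ⊥-elim (¬p p)
other-copy c1 (c2 , p) _  = p
other-copy c2 (c1 , p) _  = p
other-copy c2 (c2 , p) ¬p = ⊥-elim (¬p p)

path₃-ends-distinct : ∀ {n} {G : Graph n} {u v w}
  → IsPath G u w (u ∷ v ∷ w ∷ []) → u ≢ w
path₃-ends-distinct (_ , ((_ ∷ u≢w ∷ []) ∷ _) , _) = u≢w

unique-path₃⇒unique-common-neighbour : ∀ {n} (G : Graph n) {u₀ u₁ u₂ w}
  → u₀ ≢ u₂
  → (∀ P → IsPath G u₀ u₂ P → P ≡ u₀ ∷ u₁ ∷ u₂ ∷ [])
  → Adj G u₀ w → Adj G w u₂ → w ≡ u₁
unique-path₃⇒unique-common-neighbour G {u₀} {u₁} {u₂} {w} u₀≢u₂ unique u₀w wu₂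
  with unique (u₀ ∷ w ∷ u₂ ∷ []) (u₀wu₂-linked , u₀wu₂-distinct , refl , refl)
  where
  u₀wu₂-linked : Linked (Adj G) (u₀ ∷ w ∷ u₂ ∷ [])
  u₀wu₂-linked = u₀w ∷ wu₂ ∷ [-]
  u₀wu₂-distinct : Unique (u₀ ∷ w ∷ u₂ ∷ [])
  u₀wu₂-distinct =
    ((λ { refl → irrefl G u₀w }) ∷ u₀≢u₂ ∷ [])
    ∷ ((λ { refl → irrefl G wu₂ }) ∷ [])
    ∷ [] ∷ []
... | refl = refl

module _ {n} {G : Graph n} (D : Orientation G) where

  Through : V2 n → V2 n → V2 n → Set
  Through x m y = Arc D x m × Arc D m y

  Via : V2 n → Fin n → V2 n → Set
  Via x u y = Σ Copy λ a → Through x (a , u) y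

  walk₂-via-unique-common-neighbour : ∀ {p q v w u}
    → (∀ m → Adj G v m → Adj G m w → m ≡ u)
    → Walk D (p , v) (q , w) 2 → Via (p , v) u (q , w)
  walk₂-via-unique-common-neighbour common ((a , m) , x→m , _ , m→y , refl)
    with common m (arc-edge D x→m) (arc-edge D m→y)
  ... | refl = a , x→m , m→y

  fans-from-copy : ∀ {u₀ u₁ u₂}
    → (∀ p q → Via (p , u₀) u₁ (q , u₂))
    → (∀ p q → Via (p , u₂) u₁ (q , u₀))
    → ∀ a → Through (c1 , u₀) (a , u₁) (c1 , u₂)
    → Fan D (flip a , u₁) (c1 , u₀) (c2 , u₀) (a , u₁)
      × Fan D (a , u₁) (c1 , u₂) (c2 , u₂) (flip a , u₁)
  fans-from-copy {u₀} {u₁} {u₂} via₀₂ via₂₀ a (1₀→a , a→1₂) =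
    ( (proj₂ back₁₁ , proj₂ back₁₂ , 1₀→a , proj₁ fwd₂₁)
    , (a→1₂ , proj₂ fwd₁₂ , proj₁ back₁₁ , proj₁ back₂₁) )
    where
    through-a : ∀ {x y} → Via x u₁ y → ¬ Through x (flip a , u₁) y → Through x (a , u₁) y
    through-a {x} {y} v ¬ā =
      subst (λ b → Through x (b , u₁) y) (flip-involutive a) (other-copy (flip a) v ¬ā)

    through-ā : ∀ {x y} → Via x u₁ y → ¬ Through x (a , u₁) y → Through x (flip a , u₁) y
    through-ā = other-copy a

    back₁₁ : Through (c1 , u₂) (flip a , u₁) (c1 , u₀)
    back₁₁ = through-ā (via₂₀ c1 c1) λ (1₂→a , _) → antisym D a→1₂ 1₂→a

    back₂₁ : Through (c2 , u₂) (flip a , u₁) (c1 , u₀)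
    back₂₁ = through-ā (via₂₀ c2 c1) λ (_ , a→1₀) → antisym D 1₀→a a→1₀

    back₁₂ : Through (c1 , u₂) (flip a , u₁) (c2 , u₀)
    back₁₂ = through-ā (via₂₀ c1 c2) λ (1₂→a , _) → antisym D a→1₂ 1₂→a

    fwd₂₁ : Through (c2 , u₀) (a , u₁) (c1 , u₂)
    fwd₂₁ = through-a (via₀₂ c2 c1) λ (_ , ā→1₂) → antisym D (proj₁ back₁₁) ā→1₂

    fwd₁₂ : Through (c1 , u₀) (a , u₁) (c2 , u₂)
    fwd₁₂ = through-a (via₀₂ c1 c2) λ (1₀→ā , _) → antisym D (proj₂ back₁₁) 1₀→ā

lemma3p1 : ∀ {n} (G : Graph n) (D : Orientation G) (u₀ u₁ u₂ : Fin n)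
    → IsPath G u₀ u₂ (u₀ ∷ u₁ ∷ u₂ ∷ [])
    → (∀ P → IsPath G u₀ u₂ P → P ≡ u₀ ∷ u₁ ∷ u₂ ∷ [])
    → (∀ p q → Dist D (p , u₀) (q , u₂) 2)
    → (∀ p q → Dist D (p , u₂) (q , u₀) 2)
    → (Fan D (c2 , u₁) (c1 , u₀) (c2 , u₀) (c1 , u₁)
        × Fan D (c1 , u₁) (c1 , u₂) (c2 , u₂) (c2 , u₁))
      ⊎ (Fan D (c1 , u₁) (c1 , u₀) (c2 , u₀) (c2 , u₁)
        × Fan D (c2 , u₁) (c1 , u₂) (c2 , u₂) (c1 , u₁))
lemma3p1 G D u₀ u₁ u₂ path unique d₀₂ d₂₀ =
  case via₀₂ c1 c1 of λ
    { (c1 , t) → inj₁ (fans-from-copy D via₀₂ via₂₀ c1 t)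
    ; (c2 , t) → inj₂ (fans-from-copy D via₀₂ via₂₀ c2 t)
    }
  where
  common₀₂ : ∀ w → Adj G u₀ w → Adj G w u₂ → w ≡ u₁
  common₀₂ _ = unique-path₃⇒unique-common-neighbour G (path₃-ends-distinct {G = G} path) unique

  common₂₀ : ∀ w → Adj G u₂ w → Adj G w u₀ → w ≡ u₁
  common₂₀ w u₂w wu₀ = common₀₂ w (sym G wu₀) (sym G u₂w)

  via₀₂ : ∀ p q → Via D (p , u₀) u₁ (q , u₂)
  via₀₂ p q = walk₂-via-unique-common-neighbour D common₀₂ (proj₁ (d₀₂ p q))

  via₂₀ : ∀ p q → Via D (p , u₂) u₁ (q , u₀)
  via₂₀ p q = walk₂-via-unique-common-neighbour D common₂₀ (proj₁ (d₂₀ p q))
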